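{- Let $k$ be a positive integer and suppose that for infinitely many primes $p$, every nice subset of $\mathbb{Z}_p$ of size $k$ admits an Alspach ordering. Then every nice subset of $\mathbb{Z}$ of size $k$ admits an Alspach ordering.
   Context: A finite subset $A$ of an abelian group $G$ is called nice if $0_G\notin A$ and $\sum_{z\in A} z\neq 0_G$. For a finite subset $A=\{x_1,\dots,x_k\}$ of $G$ and an ordering $\omega=(x_{j_1},\dots,x_{j_k})$ of its elements, the partial sums are $s_i(\omega)=x_{j_1}+\dots+x_{j_i}$ for $i=1,\dots,k$. An ordering $\omega$ of $A$ is called an Alspach ordering if $s_i(\omega)\neq 0_G$ for all $i$ and $s_i(\omega)\neq s_j(\omega)$ for all $1\le i<j\le k$. -}

module Defs where

open import Data.Nat as ℕ using (ℕ; suc)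
open import Data.Nat.DivMod using (_mod_)
open import Data.Fin as Fin using (Fin; toℕ)
open import Data.Integer as ℤ using (ℤ)
open import Data.List using (List; []; _∷_; length; foldr)
open import Data.List.Membership.Propositional using (_∉_)
open import Data.List.Relation.Unary.All using (All)
open import Data.List.Relation.Unary.Unique.Propositional using (Unique)
open import Data.List.Relation.Binary.Permutation.Propositional using (_↭_)
open import Data.Product using (∃; _×_)
open import Relation.Binary.PropositionalEquality using (_≡_; _≢_)

-- Notions for a (commutative) group given by its carrier, zero and addition.
-- A finite subset is represented as a duplicate-free list; an ordering of it
-- is a permutation of that list.
module _ {G : Set} (0G : G) (_⊕_ : G → G → G) where

  gsum : List G → G
  gsum = foldr _⊕_ 0G

  partialSums : G → List G → List G
  partialSums acc [] = []
  partialSums acc (x ∷ xs) = (acc ⊕ x) ∷ partialSums (acc ⊕ x) xs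

  Nice : List G → Set
  Nice A = (0G ∉ A) × (gsum A ≢ 0G)

  IsAlspach : List G → Set
  IsAlspach ω = All (λ s → s ≢ 0G) (partialSums 0G ω) × Unique (partialSums 0G ω)

  HasAlspachOrdering : List G → Set
  HasAlspachOrdering A = ∃ λ ω → (ω ↭ A) × IsAlspach ω

  AllNiceAlspach : ℕ → Set
  AllNiceAlspach k = (A : List G) → Unique A → length A ≡ k → Nice A → HasAlspachOrdering A

-- ℤ_p for p = suc n, as Fin (suc n) with addition mod p
_+ₘ_ : {n : ℕ} → Fin (suc n) → Fin (suc n) → Fin (suc n)
_+ₘ_ {n} a b = (toℕ a ℕ.+ toℕ b) mod (suc n)

-- Reduction modulo p, ℤ → ℤ_p, is additive, so it carries partial sums to
-- partial sums; hence an Alspach ordering of the image of A pulls back to an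
-- ordering of A whose partial sums are nonzero and distinct (equal or zero
-- integers stay equal or zero modulo p). If p exceeds twice the sum B of the
-- absolute values of A, reduction is injective on [-B, B], which contains A,
-- 0 and the sum of A, so the image of A is again a nice set of size k.
module Submission where

open import Defs
open import Data.Nat using (ℕ; suc; _≤_; _>_)
open import Data.Nat.Primality using (Prime)
open import Data.Fin using (Fin)
open import Data.Integer using (ℤ; 0ℤ; _+_)
open import Data.Product using (∃; _×_)

import Data.Nat as ℕ
import Data.Nat.Properties as ℕ
open import Data.Nat.DivMod using (_%_; m%n<n)
open import Data.Nat.Divisibility using (>⇒∤) renaming (_∣_ to _∣ℕ_)
open import Data.Nat.ListAction using (sum)
open import Data.Integer using (+_; _-_; _*_; ∣_∣; _%ℕ_; _/ℕ_)
open import Data.Integer.Properties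
  using (+-injective; i-j≡0⇒i≡j; ∣i∣≡0⇒i≡0; m-n≡m⊖n; ∣m⊝n∣≤m⊔n; ∣i-j∣≤∣i∣+∣j∣; ∣i+j∣≤∣i∣+∣j∣)
open import Data.Integer.DivMod using (n%ℕd<d; a≡a%ℕn+[a/ℕn]*n)
open import Data.Integer.Divisibility.Signed using (_∣_; divides; ∣⇒∣ᵤ; ∣m∣n⇒∣m+n; ∣m∣n⇒∣m-n)
open import Data.Integer.Tactic.RingSolver using (solve-∀)
open import Data.Fin using (toℕ; fromℕ<)
open import Data.Fin.Properties using (toℕ-fromℕ<; toℕ-injective)
open import Data.List using ([]; _∷_; map)
open import Data.List.Properties using (length-map; ∷-injective)
open import Data.List.Membership.Propositional using (_∈_; _∉_)
open import Data.List.Membership.Propositional.Properties using (∈-map⁻)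
open import Data.List.Relation.Unary.All as All using (All; []; _∷_)
import Data.List.Relation.Unary.All.Properties as All
open import Data.List.Relation.Unary.Unique.Propositional using (Unique; []; _∷_)
import Data.List.Relation.Unary.Unique.Propositional.Properties as Unique
open import Data.List.Relation.Binary.Permutation.Propositional
  using (_↭_; refl; prep; swap; trans; ↭-sym)
open import Data.Product using (_,_)
open import Relation.Binary.PropositionalEquality
  using (_≡_; _≢_; refl; sym; cong; cong₂; subst; module ≡-Reasoning)
  renaming (trans to ≡-trans)
open import Relation.Nullary using (contradiction)

module _ {A B : Set} (f : A → B) where

  ↭-map⁻ : ∀ {xs ys} → map f xs ↭ ys → ∃ λ zs → (xs ↭ zs) × (map f zs ≡ ys)
  ↭-map⁻ {xs} p = lift p xs refl
    where
    lift : ∀ {us ys} → us ↭ ys → ∀ xs → us ≡ map f xs → ∃ λ zs → (xs ↭ zs) × (map f zs ≡ ys)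
    lift refl xs eq = xs , refl , sym eq
    lift (prep y p) (x ∷ xs) eq with ∷-injective eq
    ... | y≡fx , eq′ with lift p xs eq′
    ... | zs , xs↭zs , fzs≡ = x ∷ zs , prep x xs↭zs , cong₂ _∷_ (sym y≡fx) fzs≡
    lift (swap y y′ p) (x ∷ x′ ∷ xs) eq with ∷-injective eq
    ... | y≡fx , eq′ with ∷-injective eq′
    ... | y′≡fx′ , eq″ with lift p xs eq″
    ... | zs , xs↭zs , fzs≡ =
      x′ ∷ x ∷ zs , swap x x′ xs↭zs , cong₂ _∷_ (sym y′≡fx′) (cong₂ _∷_ (sym y≡fx) fzs≡)
    lift (trans p q) xs eq with lift p xs eq
    ... | zs , xs↭zs , fzs≡ with lift q zs (sym fzs≡)
    ... | zs′ , zs↭zs′ , fzs′≡ = zs′ , trans xs↭zs zs↭zs′ , fzs′≡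

module _ {A B : Set} {P : A → Set} (f : A → B)
         (f-injectiveOn : ∀ {x y} → P x → P y → f x ≡ f y → x ≡ y) where

  map-∉ : ∀ {x xs} → P x → All P xs → x ∉ xs → f x ∉ map f xs
  map-∉ px pxs x∉xs fx∈fxs with ∈-map⁻ f fx∈fxs
  ... | y , y∈xs , fx≡fy = x∉xs (subst (_∈ _) (sym (f-injectiveOn px (All.lookup pxs y∈xs) fx≡fy)) y∈xs)

  map-Unique : ∀ {xs} → All P xs → Unique xs → Unique (map f xs)
  map-Unique [] [] = []
  map-Unique (px ∷ pxs) (x≢xs ∷ xs!) =
    All.¬Any⇒All¬ _ (map-∉ px pxs (All.All¬⇒¬Any x≢xs)) ∷ map-Unique pxs xs!

module _ {G H : Set} {0G : G} {_⊕_ : G → G → G} {0H : H} {_⊞_ : H → H → H}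
         (f : G → H) (f-0 : f 0G ≡ 0H) (f-⊕ : ∀ a b → f (a ⊕ b) ≡ f a ⊞ f b) where

  gsum-map : ∀ xs → gsum 0H _⊞_ (map f xs) ≡ f (gsum 0G _⊕_ xs)
  gsum-map [] = sym f-0
  gsum-map (x ∷ xs) = ≡-trans (cong (f x ⊞_) (gsum-map xs)) (sym (f-⊕ x (gsum 0G _⊕_ xs)))

  partialSums-map : ∀ acc xs → partialSums 0H _⊞_ (f acc) (map f xs) ≡ map f (partialSums 0G _⊕_ acc xs)
  partialSums-map acc [] = refl
  partialSums-map acc (x ∷ xs) rewrite sym (f-⊕ acc x) = cong (f (acc ⊕ x) ∷_) (partialSums-map (acc ⊕ x) xs)

  IsAlspach-map⁻ : ∀ ω → IsAlspach 0H _⊞_ (map f ω) → IsAlspach 0G _⊕_ ω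
  IsAlspach-map⁻ ω (nonzero , distinct) =
    All.map (λ fs≢0 s≡0 → fs≢0 (≡-trans (cong f s≡0) f-0)) (All.map⁻ (subst (All _) sums≡ nonzero)) ,
    Unique.map⁻ (subst Unique sums≡ distinct)
    where
    sums≡ : partialSums 0H _⊞_ 0H (map f ω) ≡ map f (partialSums 0G _⊕_ 0G ω)
    sums≡ = subst (λ z → partialSums 0H _⊞_ z (map f ω) ≡ _) f-0 (partialSums-map 0G ω)

  HasAlspachOrdering-map⁻ : ∀ A → HasAlspachOrdering 0H _⊞_ (map f A) → HasAlspachOrdering 0G _⊕_ A
  HasAlspachOrdering-map⁻ A (ω̄ , ω̄↭fA , alspach) with ↭-map⁻ f (↭-sym ω̄↭fA)
  ... | ω , A↭ω , fω≡ω̄ = ω , ↭-sym A↭ω , IsAlspach-map⁻ ω (subst (IsAlspach 0H _⊞_) (sym fω≡ω̄) alspach)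

∣gsum∣≤sum∣∣ : ∀ xs → ∣ gsum 0ℤ _+_ xs ∣ ≤ sum (map ∣_∣ xs)
∣gsum∣≤sum∣∣ [] = ℕ.z≤n
∣gsum∣≤sum∣∣ (x ∷ xs) = ℕ.≤-trans (∣i+j∣≤∣i∣+∣j∣ x _) (ℕ.+-monoʳ-≤ ∣ x ∣ (∣gsum∣≤sum∣∣ xs))

∣∣≤sum∣∣ : ∀ xs → All (λ x → ∣ x ∣ ≤ sum (map ∣_∣ xs)) xs
∣∣≤sum∣∣ [] = []
∣∣≤sum∣∣ (x ∷ xs) =
  ℕ.m≤m+n ∣ x ∣ _ ∷ All.map (λ le → ℕ.≤-trans le (ℕ.m≤n+m _ ∣ x ∣)) (∣∣≤sum∣∣ xs)

module _ (p : ℕ) .{{_ : ℕ.NonZero p}} where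

  ∣-∣<⇒≡ : ∀ {i j} → + p ∣ i - j → ∣ i - j ∣ ℕ.< p → i ≡ j
  ∣-∣<⇒≡ {i} {j} p∣i-j small = i-j≡0⇒i≡j i j (∣i∣≡0⇒i≡0 (multiple<⇒≡0 (∣⇒∣ᵤ p∣i-j) small))
    where
    multiple<⇒≡0 : ∀ {m} → p ∣ℕ m → m ℕ.< p → m ≡ 0
    multiple<⇒≡0 {ℕ.zero} _ _ = refl
    multiple<⇒≡0 {suc m} p∣m m<p = contradiction p∣m (>⇒∤ m<p)

  ∣i-i%ℕp : ∀ i → + p ∣ i - + (i %ℕ p)
  ∣i-i%ℕp i = divides (i /ℕ p) (begin
    i - + (i %ℕ p)                          ≡⟨ cong (_- + (i %ℕ p)) (a≡a%ℕn+[a/ℕn]*n i p) ⟩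
    (+ (i %ℕ p) + i /ℕ p * + p) - + (i %ℕ p) ≡⟨ r+x-r≡x (+ (i %ℕ p)) (i /ℕ p * + p) ⟩
    i /ℕ p * + p                            ∎)
    where
    open ≡-Reasoning
    r+x-r≡x : ∀ r x → (r + x) - r ≡ x
    r+x-r≡x = solve-∀

  %ℕ-unique : ∀ i {r} → r ℕ.< p → + p ∣ i - + r → i %ℕ p ≡ r
  %ℕ-unique i {r} r<p p∣i-r = +-injective (∣-∣<⇒≡ p∣s-r ∣s-r∣<p)
    where
    s = i %ℕ p
    [i-r]-[i-s]≡s-r : ∀ i r s → (i - r) - (i - s) ≡ s - r
    [i-r]-[i-s]≡s-r = solve-∀
    p∣s-r : + p ∣ + s - + r
    p∣s-r = subst (+ p ∣_) ([i-r]-[i-s]≡s-r i (+ r) (+ s)) (∣m∣n⇒∣m-n p∣i-r (∣i-i%ℕp i))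
    ∣s-r∣<p : ∣ + s - + r ∣ ℕ.< p
    ∣s-r∣<p = subst (ℕ._< p) (cong ∣_∣ (sym (m-n≡m⊖n s r)))
                (ℕ.≤-<-trans (∣m⊝n∣≤m⊔n s r) (ℕ.⊔-lub (n%ℕd<d i p) r<p))

  %ℕ-distrib-+ : ∀ i j → (i + j) %ℕ p ≡ (i %ℕ p ℕ.+ j %ℕ p) % p
  %ℕ-distrib-+ i j = %ℕ-unique (i + j) (m%n<n (r ℕ.+ s) p) (subst (+ p ∣_) regroup
    (∣m∣n⇒∣m+n (∣m∣n⇒∣m+n (∣i-i%ℕp i) (∣i-i%ℕp j)) (∣i-i%ℕp (+ (r ℕ.+ s)))))
    where
    r = i %ℕ p
    s = j %ℕ p
    regroup′ : ∀ i j r s t → (i - r) + (j - s) + ((r + s) - t) ≡ (i + j) - t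
    regroup′ = solve-∀
    regroup : (i - + r) + (j - + s) + (+ (r ℕ.+ s) - + ((r ℕ.+ s) % p)) ≡ (i + j) - + ((r ℕ.+ s) % p)
    regroup = regroup′ i j (+ r) (+ s) (+ ((r ℕ.+ s) % p))

  %ℕ-injective : ∀ {i j} → ∣ i ∣ ℕ.+ ∣ j ∣ ℕ.< p → i %ℕ p ≡ j %ℕ p → i ≡ j
  %ℕ-injective {i} {j} small i%p≡j%p = ∣-∣<⇒≡ p∣i-j (ℕ.≤-<-trans (∣i-j∣≤∣i∣+∣j∣ i j) small)
    where
    [i-r]-[j-r]≡i-j : ∀ i j r → (i - r) - (j - r) ≡ i - j
    [i-r]-[j-r]≡i-j = solve-∀
    p∣i-j : + p ∣ i - j
    p∣i-j = subst (+ p ∣_) ([i-r]-[j-r]≡i-j i j (+ (i %ℕ p)))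
      (∣m∣n⇒∣m-n (∣i-i%ℕp i) (subst (λ r → + p ∣ j - + r) (sym i%p≡j%p) (∣i-i%ℕp j)))

reduce : ∀ {n} → ℤ → Fin (suc n)
reduce {n} i = fromℕ< (n%ℕd<d i (suc n))

toℕ-reduce : ∀ {n} i → toℕ (reduce {n} i) ≡ i %ℕ suc n
toℕ-reduce i = toℕ-fromℕ< _

reduce-+ : ∀ {n} i j → reduce {n} (i + j) ≡ reduce i +ₘ reduce j
reduce-+ {n} i j = toℕ-injective (begin
  toℕ (reduce (i + j))                          ≡⟨ toℕ-reduce (i + j) ⟩
  (i + j) %ℕ suc n                              ≡⟨ %ℕ-distrib-+ (suc n) i j ⟩
  (i %ℕ suc n ℕ.+ j %ℕ suc n) % suc n           ≡⟨ cong₂ (λ r s → (r ℕ.+ s) % suc n) (toℕ-reduce i) (toℕ-reduce j) ⟨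
  (toℕ (reduce i) ℕ.+ toℕ (reduce j)) % suc n   ≡⟨ toℕ-fromℕ< _ ⟨
  toℕ (reduce i +ₘ reduce j)                    ∎)
  where open ≡-Reasoning

reduce-injective : ∀ {n i j} → ∣ i ∣ ℕ.+ ∣ j ∣ ℕ.< suc n → reduce {n} i ≡ reduce j → i ≡ j
reduce-injective {n} {i} {j} small eq =
  %ℕ-injective (suc n) small (≡-trans (sym (toℕ-reduce i)) (≡-trans (cong toℕ eq) (toℕ-reduce j)))

proposition2p2 : (k : ℕ) → k > 0
    → ((N : ℕ) → ∃ λ n → (N ≤ suc n) × Prime (suc n) × AllNiceAlspach {Fin (suc n)} Fin.zero _+ₘ_ k)
    → AllNiceAlspach {ℤ} 0ℤ _+_ k
proposition2p2 k _ primes A A! ∣A∣≡k (0∉A , ΣA≢0) with primes (suc (sum (map ∣_∣ A) ℕ.+ sum (map ∣_∣ A)))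
... | n , 2B<p , _ , alspach-mod-p =
  HasAlspachOrdering-map⁻ reduce refl reduce-+ A
    (alspach-mod-p (map reduce A) (map-Unique reduce injectiveOn A-bounded A!)
      (≡-trans (length-map reduce A) ∣A∣≡k)
      (map-∉ reduce injectiveOn ℕ.z≤n A-bounded 0∉A , reduce-ΣA≢0))
  where
  B = sum (map ∣_∣ A)
  A-bounded = ∣∣≤sum∣∣ A
  injectiveOn : ∀ {i j} → ∣ i ∣ ≤ B → ∣ j ∣ ≤ B → reduce {n} i ≡ reduce j → i ≡ j
  injectiveOn i≤B j≤B = reduce-injective (ℕ.≤-<-trans (ℕ.+-mono-≤ i≤B j≤B) 2B<p)
  reduce-ΣA≢0 : gsum Fin.zero _+ₘ_ (map reduce A) ≢ Fin.zero
  reduce-ΣA≢0 eq = ΣA≢0 (injectiveOn (∣gsum∣≤sum∣∣ A) ℕ.z≤n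
    (≡-trans (sym (gsum-map reduce refl reduce-+ A)) eq))
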